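{- Let $\vec b=(b_0,b_1,\dots)$ be an infinite sequence of integers. For every integer $n\ge1$, $\widehat{C}^{\vec b}_{4,4,n}=\widehat{C}^{\vec b}_{4,5,n}=(b_0b_3)^n$.
   Context: A $k$-dimensional balanced ballot path of length $kn$ is a sequence of $kn$ standard unit vectors of $\mathbb{R}^k$, each $\vec e_i$ occurring exactly $n$ times, such that every intermediate point (partial sum) $\vec x=(x_1,\dots,x_k)$ satisfies $x_1\ge\cdots\ge x_k$. The semisymmetric height of $\vec x$ is $g_k(\vec x)=\sum_{i=1}^k(k+1-2i)x_i$ and the semisymmetric height $g_k(P)$ of a path is the maximum of $g_k$ over its intermediate points. Steps $\vec e_i$ with $i\le\lfloor k/2\rfloor$ are semisymmetric up-steps. For a sequence $\vec b$, the weight $sswt_{\vec b}(P)$ is the product, over all up-steps of $P$, of $b_h$ where $h$ is the semisymmetric height of the starting point of that up-step. Define $\widehat{C}^{\vec b}_{k,u,n}=\sum_P sswt_{\vec b}(P)$, summed over all $k$-dimensional balanced ballot paths of length $kn$ with $g_k(P)\le u$. -}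

module Defs where

open import Data.Nat as ℕ using (ℕ; zero; suc; _<_; _≤_)
open import Data.Nat.DivMod using (_/_)
open import Data.Integer as ℤ using (ℤ; +_; ∣_∣)
open import Data.Fin as Fin using (Fin; toℕ)
open import Data.Fin.Properties using (all?)
open import Data.Vec as Vec using (Vec; lookup; replicate; updateAt)
open import Data.List as List using (List; []; _∷_; foldr; map; filter; length; allFin; concatMap)
open import Data.Product using (_×_)
open import Relation.Nullary using (Dec; yes; no; does)
open import Data.Bool using (Bool; if_then_else_)
open import Data.List.Relation.Unary.All as All using (All)
open import Relation.Nullary.Decidable using (_×-dec_; _→-dec_)
open import Relation.Binary.PropositionalEquality using (_≡_)

-- Lattice points of ℝ^k with natural coordinates; coordinate i (0-based)
-- is x_{i+1} of the paper.
Point : ℕ → Set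
Point k = Vec ℕ k

origin : (k : ℕ) → Point k
origin k = replicate k 0

-- A path is a word of unit steps; the step i : Fin k is e_{i+1}.
Path : ℕ → Set
Path k = List (Fin k)

step : {k : ℕ} → Point k → Fin k → Point k
step x i = updateAt x i suc

pointsFrom : {k : ℕ} → Point k → Path k → List (Point k)
pointsFrom x []      = x ∷ []
pointsFrom x (i ∷ P) = x ∷ pointsFrom (step x i) P

points : {k : ℕ} → Path k → List (Point k)
points {k} P = pointsFrom (origin k) P

occurrences : {k : ℕ} → Fin k → Path k → ℕ
occurrences i P = length (filter (Fin._≟ i) P)

Weakly-decreasing : {k : ℕ} → Point k → Set
Weakly-decreasing {k} x = (i j : Fin k) → toℕ i ℕ.≤ toℕ j → lookup x j ℕ.≤ lookup x i

ssheightPt : {k : ℕ} → Point k → ℤ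
ssheightPt {k} x =
  foldr ℤ._+_ (+ 0)
    (map (λ i → ((+ (k ℕ.+ 1)) ℤ.- (+ (2 ℕ.* suc (toℕ i)))) ℤ.* (+ lookup x i)) (allFin k))

-- semisymmetric height of a path: maximum of g_k over its points
-- (the list of points is nonempty and contains the origin, where g_k = 0).
ssheight : {k : ℕ} → Path k → ℤ
ssheight {k} P = foldr ℤ._⊔_ (ssheightPt (origin k)) (map ssheightPt (points P))

-- The length kn is enforced
-- by enumerating words of length k * n (see `words` below).
IsBallotPath : (k u n : ℕ) → Path k → Set
IsBallotPath k u n P =
  ((i : Fin k) → occurrences i P ≡ n)
  × All Weakly-decreasing (points P)
  × ssheight P ℤ.≤ + u

weakly-decreasing? : {k : ℕ} → (x : Point k) → Dec (Weakly-decreasing x)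
weakly-decreasing? x =
  all? (λ i → all? (λ j → (toℕ i ℕ.≤? toℕ j) →-dec (lookup x j ℕ.≤? lookup x i)))

isBallotPath? : (k u n : ℕ) → (P : Path k) → Dec (IsBallotPath k u n P)
isBallotPath? k u n P =
  all? (λ i → occurrences i P ℕ.≟ n)
  ×-dec (All.all? weakly-decreasing? (points P)
  ×-dec (ssheight P ℤ.≤? + u))

words : (k m : ℕ) → List (Path k)
words k zero    = [] ∷ []
words k (suc m) = concatMap (λ i → map (i ∷_) (words k m)) (allFin k)

isUpStep : {k : ℕ} → Fin k → Bool
isUpStep {k} i = does (suc (toℕ i) ℕ.≤? k / 2)

-- sswt_b of a path started at x: product over up-steps of b_h, where h is the
-- semisymmetric height of the starting point of the step (h ≥ 0 on ballot
-- paths, so ∣ h ∣ = h there).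
sswtFrom : {k : ℕ} → (ℕ → ℤ) → Point k → Path k → ℤ
sswtFrom b x []      = + 1
sswtFrom b x (i ∷ P) =
  (if isUpStep i then b ∣ ssheightPt x ∣ else + 1) ℤ.* sswtFrom b (step x i) P

sswt : {k : ℕ} → (ℕ → ℤ) → Path k → ℤ
sswt {k} b P = sswtFrom b (origin k) P

Chat : (b : ℕ → ℤ) (k u n : ℕ) → ℤ
Chat b k u n =
  foldr ℤ._+_ (+ 0) (map (sswt b) (filter (isBallotPath? k u n) (words k (k ℕ.* n))))

{-# OPTIONS --safe #-}
-- With semisymmetric height at most 5 a four-dimensional ballot path has no
-- choice: from j(1,1,1,1) + e₁ + ⋯ + eᵣ every step other than e_{r+1} either
-- breaks x₁ ≥ x₂ ≥ x₃ ≥ x₄ or, for e₁ with r ≥ 1, reaches height 6 or 7.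
-- So the only path is (e₁e₂e₃e₄)ⁿ, whose height never exceeds 4; its up-steps
-- e₁ and e₂ start at heights 0 and 3, contributing b₀b₃ per period.
module Submission where

open import Defs
open import Data.Nat using (ℕ; _≤_)
open import Data.Integer using (ℤ; _*_; _^_)
open import Data.Product using (_×_)
open import Relation.Binary.PropositionalEquality using (_≡_)

open import Level using (Level; 0ℓ)
open import Function using (_∘_; id)
open import Data.Nat as ℕ using (zero; suc; z≤n)
import Data.Nat.Properties as ℕP
open import Data.Integer as ℤ using (+_; +≤+; +<+; ∣_∣)
import Data.Integer.Properties as ℤP
open import Data.Integer.Tactic.RingSolver using (solve-∀)
open import Data.Fin as Fin using (Fin)
open import Data.Fin.Properties using (all?; suc-injective)
open import Data.Vec as Vec using (_∷_; [])
open import Data.Vec.Properties using (lookup-map)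
open import Data.List as List using (List; []; _∷_; _++_; map; filter; concat; tabulate; allFin; length; foldr)
import Data.List.Properties as Listₚ
open import Data.List.Relation.Unary.All as All using (All; []; _∷_)
import Data.List.Relation.Unary.All.Properties as Allₚ
open import Data.Product using (_,_; proj₁; proj₂)
open import Data.Bool using (true; false)
open import Data.Empty using (⊥-elim)
open import Relation.Nullary using (¬_; does)
open import Relation.Nullary.Decidable using (from-yes; _×-dec_)
open import Relation.Unary using (Pred; Decidable; _∩_)
open import Relation.Binary.PropositionalEquality
  using (refl; sym; trans; cong; cong₂; subst; subst₂; _≢_; module ≡-Reasoning)
open ≡-Reasoning

private
  variable
    a ℓ : Level
    A B : Set a

pattern 0F = Fin.zero
pattern 1F = Fin.suc Fin.zero
pattern 2F = Fin.suc (Fin.suc Fin.zero)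
pattern 3F = Fin.suc (Fin.suc (Fin.suc Fin.zero))

filter-map : {P : Pred B ℓ} (P? : Decidable P) (f : A → B) (xs : List A) →
             filter P? (map f xs) ≡ map f (filter (P? ∘ f) xs)
filter-map P? f [] = refl
filter-map P? f (x ∷ xs) with does (P? (f x))
... | true  = cong (f x ∷_) (filter-map P? f xs)
... | false = filter-map P? f xs

filter-concat : {P : Pred A ℓ} (P? : Decidable P) (xss : List (List A)) →
                filter P? (concat xss) ≡ concat (map (filter P?) xss)
filter-concat P? [] = refl
filter-concat P? (xs ∷ xss) =
  trans (Listₚ.filter-++ P? xs (concat xss)) (cong (filter P? xs ++_) (filter-concat P? xss))

concat-tabulate-[] : ∀ {n} (f : Fin n → List A) → (∀ i → f i ≡ []) → concat (tabulate f) ≡ []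
concat-tabulate-[] {n = zero}  f f≡[] = refl
concat-tabulate-[] {n = suc n} f f≡[] rewrite f≡[] 0F = concat-tabulate-[] (f ∘ Fin.suc) (f≡[] ∘ Fin.suc)

concat-tabulate-single : ∀ {n} (f : Fin n → List A) (i₀ : Fin n) →
                         (∀ i → i ≢ i₀ → f i ≡ []) → concat (tabulate f) ≡ f i₀
concat-tabulate-single f 0F f≡[] =
  trans (cong (f 0F ++_) (concat-tabulate-[] (f ∘ Fin.suc) (λ i → f≡[] (Fin.suc i) λ ())))
        (Listₚ.++-identityʳ (f 0F))
concat-tabulate-single f (Fin.suc i₀) f≡[] rewrite f≡[] 0F (λ ()) =
  concat-tabulate-single (f ∘ Fin.suc) i₀ (λ i i≢i₀ → f≡[] (Fin.suc i) (i≢i₀ ∘ suc-injective))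

words-length : ∀ k m → All (λ w → length w ≡ m) (words k m)
words-length k zero    = refl ∷ []
words-length k (suc m) =
  Allₚ.concat⁺ (Allₚ.map⁺ (Allₚ.tabulate⁺ λ i → Allₚ.map⁺ {f = i ∷_} (All.map (cong suc) (words-length k m))))

filter-words-unique : ∀ {k m} {P : Pred (Path k) ℓ} (P? : Decidable P) {w₀ : Path k} →
                      length w₀ ≡ m → P w₀ → (∀ {w} → length w ≡ m → P w → w ≡ w₀) →
                      filter P? (words k m) ≡ w₀ ∷ []
filter-words-unique {m = zero} P? {[]} _ Pw₀ _ = Listₚ.filter-accept P? Pw₀
filter-words-unique {k = k} {m = suc m} P? {i₀ ∷ w₀} |w₀| Pw₀ unique = begin
  filter P? (concat (map block (allFin k)))       ≡⟨ filter-concat P? (map block (allFin k)) ⟩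
  concat (map (filter P?) (map block (allFin k))) ≡⟨ cong concat (sym (Listₚ.map-∘ (allFin k))) ⟩
  concat (map (filter P? ∘ block) (allFin k))     ≡⟨ cong concat (Listₚ.map-tabulate id (filter P? ∘ block)) ⟩
  concat (tabulate (filter P? ∘ block))           ≡⟨ concat-tabulate-single _ i₀ other-block ⟩
  filter P? (block i₀)                            ≡⟨ filter-map P? (i₀ ∷_) (words k m) ⟩
  map (i₀ ∷_) (filter (P? ∘ (i₀ ∷_)) (words k m)) ≡⟨ cong (map (i₀ ∷_)) tail-unique ⟩
  (i₀ ∷ w₀) ∷ []                                  ∎
  where
  block : Fin k → List (Path k)
  block i = map (i ∷_) (words k m)

  tail-unique : filter (P? ∘ (i₀ ∷_)) (words k m) ≡ w₀ ∷ []
  tail-unique = filter-words-unique (P? ∘ (i₀ ∷_)) (ℕP.suc-injective |w₀|) Pw₀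
    (λ |w| Pw → Listₚ.∷-injectiveʳ (unique (cong suc |w|) Pw))

  other-block : ∀ i → i ≢ i₀ → filter P? (block i) ≡ []
  other-block i i≢i₀ = Listₚ.filter-none P? (Allₚ.map⁺ {f = i ∷_} (All.map
    (λ |w| Pw → i≢i₀ (Listₚ.∷-injectiveˡ (unique (cong suc |w|) Pw))) (words-length k m)))

HeightAtMost : {k : ℕ} → ℕ → Pred (Point k) 0ℓ
HeightAtMost u x = ssheightPt x ℤ.≤ + u

foldr-⊔-≤⁻ : ∀ {u} a (xs : List ℤ) → foldr ℤ._⊔_ a xs ℤ.≤ u → All (ℤ._≤ u) xs
foldr-⊔-≤⁻ a []       _ = []
foldr-⊔-≤⁻ a (x ∷ xs) ≤u =
  ℤP.≤-trans (ℤP.i≤i⊔j x _) ≤u ∷ foldr-⊔-≤⁻ a xs (ℤP.≤-trans (ℤP.i≤j⊔i x _) ≤u)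

foldr-⊔-≤⁺ : ∀ {u} a (xs : List ℤ) → a ℤ.≤ u → All (ℤ._≤ u) xs → foldr ℤ._⊔_ a xs ℤ.≤ u
foldr-⊔-≤⁺ a []       a≤u []           = a≤u
foldr-⊔-≤⁺ a (x ∷ xs) a≤u (x≤u ∷ xs≤u) = ℤP.⊔-lub x≤u (foldr-⊔-≤⁺ a xs a≤u xs≤u)

ssheight-≤⁻ : ∀ {k u} (P : Path k) → ssheight P ℤ.≤ + u → All (HeightAtMost u) (points P)
ssheight-≤⁻ {k} P ≤u = Allₚ.map⁻ (foldr-⊔-≤⁻ (ssheightPt (origin k)) (map ssheightPt (points P)) ≤u)

pointsFrom-head : ∀ {k} {R : Pred (Point k) ℓ} {x} (P : Path k) → All R (pointsFrom x P) → R x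
pointsFrom-head []      (Rx ∷ _) = Rx
pointsFrom-head (_ ∷ _) (Rx ∷ _) = Rx

ssheight-≤⁺ : ∀ {k u} (P : Path k) → All (HeightAtMost u) (points P) → ssheight P ℤ.≤ + u
ssheight-≤⁺ {k} P ≤u =
  foldr-⊔-≤⁺ (ssheightPt (origin k)) (map ssheightPt (points P)) (pointsFrom-head P ≤u) (Allₚ.map⁺ ≤u)

translate : {k : ℕ} → ℕ → Point k → Point k
translate j = Vec.map (ℕ._+ j)

Weakly-decreasing-translate : ∀ {k} j {y : Point k} → Weakly-decreasing y → Weakly-decreasing (translate j y)
Weakly-decreasing-translate j {y} dec i i′ i≤i′ =
  subst₂ _≤_ (sym (lookup-map i′ (ℕ._+ j) y)) (sym (lookup-map i (ℕ._+ j) y)) (ℕP.+-monoˡ-≤ j (dec i i′ i≤i′))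

-- The coefficients 3, 1, -1, -3 of g₄ sum to zero.
ssheightPt-translate : ∀ j (y : Point 4) → ssheightPt (translate j y) ≡ ssheightPt y
ssheightPt-translate j (a ∷ b ∷ c ∷ d ∷ [])
  rewrite ℤP.pos-+ a j | ℤP.pos-+ b j | ℤP.pos-+ c j | ℤP.pos-+ d j = g₄-translate (+ a) (+ b) (+ c) (+ d) (+ j)
  where
  g₄-translate : ∀ a b c d j →
    + 3 * (a ℤ.+ j) ℤ.+ (+ 1 * (b ℤ.+ j) ℤ.+ (ℤ.- + 1 * (c ℤ.+ j) ℤ.+ (ℤ.- + 3 * (d ℤ.+ j) ℤ.+ + 0)))
      ≡ + 3 * a ℤ.+ (+ 1 * b ℤ.+ (ℤ.- + 1 * c ℤ.+ (ℤ.- + 3 * d ℤ.+ + 0)))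
  g₄-translate = solve-∀

Admissible : ℕ → Pred (Point 4) 0ℓ
Admissible u = Weakly-decreasing ∩ HeightAtMost u

admissible? : ∀ u → Decidable (Admissible u)
admissible? u x = weakly-decreasing? x ×-dec (ssheightPt x ℤ.≤? + u)

Admissible-translate : ∀ {u} j y → Admissible u y → Admissible u (translate j y)
Admissible-translate j y (dec , ≤u) =
  Weakly-decreasing-translate j {y} dec , subst (ℤ._≤ + _) (sym (ssheightPt-translate j y)) ≤u

corner : Fin 4 → Point 4
corner 0F = 0 ∷ 0 ∷ 0 ∷ 0 ∷ []
corner 1F = 1 ∷ 0 ∷ 0 ∷ 0 ∷ []
corner 2F = 1 ∷ 1 ∷ 0 ∷ 0 ∷ []
corner 3F = 1 ∷ 1 ∷ 1 ∷ 0 ∷ []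

corner-admissible : ∀ r → Admissible 4 (corner r)
corner-admissible = from-yes (all? (admissible? 4 ∘ corner))

exceeds-5 : ∀ j (y : Point 4) {m} → ssheightPt y ≡ + (6 ℕ.+ m) → ¬ HeightAtMost 5 (translate j y)
exceeds-5 j y {m} y≡6+m ≤5 =
  ℤP.<⇒≱ (+<+ (ℕP.m≤m+n 6 m)) (subst (ℤ._≤ + 5) (trans (ssheightPt-translate j y) y≡6+m) ≤5)

next : Fin 4 → Fin 4
next 0F = 1F
next 1F = 2F
next 2F = 3F
next 3F = 0F

cycleFrom : Fin 4 → ℕ → Path 4
cycleFrom r zero    = []
cycleFrom r (suc m) = r ∷ cycleFrom (next r) m

-- A wrong step from corner r either makes some xᵢ₊₁ exceed xᵢ or, for e₁,
-- leads to (2,0,0,0), (2,1,0,0) or (2,1,1,0), of heights 6, 7 and 6.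
cycleFrom-forced : ∀ r j (P : Path 4) → All (Admissible 5) (pointsFrom (translate j (corner r)) P) →
                   P ≡ cycleFrom r (length P)
cycleFrom-forced r  j []       _         = refl
cycleFrom-forced 0F j (0F ∷ P) (_ ∷ adm) = cong (0F ∷_) (cycleFrom-forced 1F j P adm)
cycleFrom-forced 1F j (1F ∷ P) (_ ∷ adm) = cong (1F ∷_) (cycleFrom-forced 2F j P adm)
cycleFrom-forced 2F j (2F ∷ P) (_ ∷ adm) = cong (2F ∷_) (cycleFrom-forced 3F j P adm)
cycleFrom-forced 3F j (3F ∷ P) (_ ∷ adm) = cong (3F ∷_) (cycleFrom-forced 0F (suc j) P adm)
cycleFrom-forced 0F j (1F ∷ P) (_ ∷ adm) = ⊥-elim (ℕP.1+n≰n (proj₁ (pointsFrom-head P adm) 0F 1F z≤n))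
cycleFrom-forced 0F j (2F ∷ P) (_ ∷ adm) = ⊥-elim (ℕP.1+n≰n (proj₁ (pointsFrom-head P adm) 1F 2F (ℕP.n≤1+n 1)))
cycleFrom-forced 0F j (3F ∷ P) (_ ∷ adm) = ⊥-elim (ℕP.1+n≰n (proj₁ (pointsFrom-head P adm) 2F 3F (ℕP.n≤1+n 2)))
cycleFrom-forced 1F j (0F ∷ P) (_ ∷ adm) = ⊥-elim (exceeds-5 j (2 ∷ 0 ∷ 0 ∷ 0 ∷ []) refl (proj₂ (pointsFrom-head P adm)))
cycleFrom-forced 1F j (2F ∷ P) (_ ∷ adm) = ⊥-elim (ℕP.1+n≰n (proj₁ (pointsFrom-head P adm) 1F 2F (ℕP.n≤1+n 1)))
cycleFrom-forced 1F j (3F ∷ P) (_ ∷ adm) = ⊥-elim (ℕP.1+n≰n (proj₁ (pointsFrom-head P adm) 2F 3F (ℕP.n≤1+n 2)))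
cycleFrom-forced 2F j (0F ∷ P) (_ ∷ adm) = ⊥-elim (exceeds-5 j (2 ∷ 1 ∷ 0 ∷ 0 ∷ []) refl (proj₂ (pointsFrom-head P adm)))
cycleFrom-forced 2F j (1F ∷ P) (_ ∷ adm) = ⊥-elim (ℕP.1+n≰n (proj₁ (pointsFrom-head P adm) 0F 1F z≤n))
cycleFrom-forced 2F j (3F ∷ P) (_ ∷ adm) = ⊥-elim (ℕP.1+n≰n (proj₁ (pointsFrom-head P adm) 2F 3F (ℕP.n≤1+n 2)))
cycleFrom-forced 3F j (0F ∷ P) (_ ∷ adm) = ⊥-elim (exceeds-5 j (2 ∷ 1 ∷ 1 ∷ 0 ∷ []) refl (proj₂ (pointsFrom-head P adm)))
cycleFrom-forced 3F j (1F ∷ P) (_ ∷ adm) = ⊥-elim (ℕP.1+n≰n (proj₁ (pointsFrom-head P adm) 0F 1F z≤n))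
cycleFrom-forced 3F j (2F ∷ P) (_ ∷ adm) = ⊥-elim (ℕP.1+n≰n (proj₁ (pointsFrom-head P adm) 1F 2F (ℕP.n≤1+n 1)))

cyclicPath : ℕ → Path 4
cyclicPath zero    = []
cyclicPath (suc n) = 0F ∷ 1F ∷ 2F ∷ 3F ∷ cyclicPath n

cycleFrom-cyclicPath : ∀ n → cycleFrom 0F (4 ℕ.* n) ≡ cyclicPath n
cycleFrom-cyclicPath zero    = refl
cycleFrom-cyclicPath (suc n) =
  trans (cong (cycleFrom 0F) (ℕP.*-suc 4 n)) (cong (λ P → 0F ∷ 1F ∷ 2F ∷ 3F ∷ P) (cycleFrom-cyclicPath n))

length-cyclicPath : ∀ n → length (cyclicPath n) ≡ 4 ℕ.* n
length-cyclicPath zero    = refl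
length-cyclicPath (suc n) = trans (cong (4 ℕ.+_) (length-cyclicPath n)) (sym (ℕP.*-suc 4 n))

occurrences-cyclicPath : ∀ i n → occurrences i (cyclicPath n) ≡ n
occurrences-cyclicPath i  zero    = refl
occurrences-cyclicPath 0F (suc n) = cong suc (occurrences-cyclicPath 0F n)
occurrences-cyclicPath 1F (suc n) = cong suc (occurrences-cyclicPath 1F n)
occurrences-cyclicPath 2F (suc n) = cong suc (occurrences-cyclicPath 2F n)
occurrences-cyclicPath 3F (suc n) = cong suc (occurrences-cyclicPath 3F n)

cyclicPath-admissible : ∀ j n → All (Admissible 4) (pointsFrom (translate j (corner 0F)) (cyclicPath n))
cyclicPath-admissible j zero    = Admissible-translate j (corner 0F) (corner-admissible 0F) ∷ []
cyclicPath-admissible j (suc n) =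
  adm 0F ∷ adm 1F ∷ adm 2F ∷ adm 3F ∷ cyclicPath-admissible (suc j) n
  where
  adm : ∀ r → Admissible 4 (translate j (corner r))
  adm r = Admissible-translate j (corner r) (corner-admissible r)

cyclicPath-isBallotPath : ∀ {u} n → 4 ≤ u → IsBallotPath 4 u n (cyclicPath n)
cyclicPath-isBallotPath n 4≤u =
  (λ i → occurrences-cyclicPath i n) ,
  proj₁ (All.unzip adm) ,
  ssheight-≤⁺ (cyclicPath n) (All.map (λ ≤4 → ℤP.≤-trans ≤4 (+≤+ 4≤u)) (proj₂ (All.unzip adm)))
  where adm = cyclicPath-admissible 0 n

ballotPath-unique : ∀ {u n} {P : Path 4} → u ≤ 5 → length P ≡ 4 ℕ.* n → IsBallotPath 4 u n P →
                    P ≡ cyclicPath n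
ballotPath-unique {n = n} {P} u≤5 |P| (_ , dec , ≤u) = begin
  P                           ≡⟨ cycleFrom-forced 0F 0 P (All.zip (dec , ≤5)) ⟩
  cycleFrom 0F (length P)     ≡⟨ cong (cycleFrom 0F) |P| ⟩
  cycleFrom 0F (4 ℕ.* n)      ≡⟨ cycleFrom-cyclicPath n ⟩
  cyclicPath n                ∎
  where
  ≤5 : All (HeightAtMost 5) (points P)
  ≤5 = All.map (λ ≤u → ℤP.≤-trans ≤u (+≤+ u≤5)) (ssheight-≤⁻ P ≤u)

ballotPaths-4≡[cyclicPath] : ∀ {u} n → 4 ≤ u → u ≤ 5 →
                filter (isBallotPath? 4 u n) (words 4 (4 ℕ.* n)) ≡ cyclicPath n ∷ []
ballotPaths-4≡[cyclicPath] n 4≤u u≤5 = filter-words-unique (isBallotPath? 4 _ n)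
  (length-cyclicPath n) (cyclicPath-isBallotPath n 4≤u) (ballotPath-unique u≤5)

sswtFrom-cyclicPath : ∀ b j n → sswtFrom b (translate j (corner 0F)) (cyclicPath n) ≡ (b 0 * b 3) ^ n
sswtFrom-cyclicPath b j zero    = refl
sswtFrom-cyclicPath b j (suc n) = begin
  b ∣ ssheightPt (translate j (corner 0F)) ∣ * (b ∣ ssheightPt (translate j (corner 1F)) ∣ * (+ 1 * (+ 1 * w)))
    ≡⟨ cong₂ (λ h₀ h₁ → b ∣ h₀ ∣ * (b ∣ h₁ ∣ * (+ 1 * (+ 1 * w))))
             (ssheightPt-translate j (corner 0F)) (ssheightPt-translate j (corner 1F)) ⟩
  b 0 * (b 3 * (+ 1 * (+ 1 * w)))
    ≡⟨ cong (λ v → b 0 * (b 3 * (+ 1 * (+ 1 * v)))) (sswtFrom-cyclicPath b (suc j) n) ⟩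
  b 0 * (b 3 * (+ 1 * (+ 1 * (b 0 * b 3) ^ n)))
    ≡⟨ regroup (b 0) (b 3) ((b 0 * b 3) ^ n) ⟩
  (b 0 * b 3) ^ suc n ∎
  where
  w : ℤ
  w = sswtFrom b (translate (suc j) (corner 0F)) (cyclicPath n)

  regroup : ∀ x y z → x * (y * (+ 1 * (+ 1 * z))) ≡ x * y * z
  regroup = solve-∀

Chat-4 : ∀ b {u} n → 4 ≤ u → u ≤ 5 → Chat b 4 u n ≡ (b 0 * b 3) ^ n
Chat-4 b n 4≤u u≤5 = begin
  foldr ℤ._+_ (+ 0) (map (sswt b) (filter (isBallotPath? 4 _ n) (words 4 (4 ℕ.* n))))
    ≡⟨ cong (foldr ℤ._+_ (+ 0) ∘ map (sswt b)) (ballotPaths-4≡[cyclicPath] n 4≤u u≤5) ⟩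
  sswt b (cyclicPath n) ℤ.+ + 0 ≡⟨ ℤP.+-identityʳ _ ⟩
  sswt b (cyclicPath n)         ≡⟨ sswtFrom-cyclicPath b 0 n ⟩
  (b 0 * b 3) ^ n               ∎

proposition4p4 : (b : ℕ → ℤ) (n : ℕ) → 1 ≤ n →
    (Chat b 4 4 n ≡ (b 0 * b 3) ^ n) × (Chat b 4 5 n ≡ (b 0 * b 3) ^ n)
proposition4p4 b n _ = Chat-4 b n ℕP.≤-refl (ℕP.n≤1+n 4) , Chat-4 b n (ℕP.n≤1+n 4) ℕP.≤-refl
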